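{- Let $t$ be a pure $\lambda$-term, let $r$ be a weak-head needed redex occurrence of $t$, and let $\Phi$ be any type derivation in system $\mathcal{V}$ with subject $t$. Then $r \in \mathrm{toc}(\Phi)$.
   Context: Pure $\lambda$-terms $t::= x\mid t\,u\mid \lambda x.t$. Occurrences are words over $\{0,1\}$: $\mathrm{oc}(x)=\{\epsilon\}$, $\mathrm{oc}(t\,u)=\{\epsilon\}\cup 0\cdot\mathrm{oc}(t)\cup 1\cdot\mathrm{oc}(u)$, $\mathrm{oc}(\lambda x.t)=\{\epsilon\}\cup 0\cdot\mathrm{oc}(t)$; redex occurrences are those $p$ with $t|_p=(\lambda x.s)v$. A redex is used in a reduction sequence if the sequence contracts it or one of its residuals (standard $\lambda$-calculus residuals). WHNF: terms $\lambda x.t$ or $x\,t_1\cdots t_n$. A redex of $t$ is weak-head needed if every $\beta$-reduction sequence from $t$ to a WHNF uses it. System $\mathcal{V}$: types $\tau ::= \mathtt{a}\mid\alpha\mid \mathcal{M}\to\tau$, $\mathcal{M}$ finite multisets of types; contexts map variables to multisets (finite support), summed pointwise by multiset union. Rules: (ax) $x:[\tau]\vdash x:\tau$; (val) $\emptyset\vdash\lambda x.t:\mathtt{a}$; ($\to$i) from $\Gamma\vdash t:\tau$ infer $\Gamma\setminus x\vdash\lambda x.t:\Gamma(x)\to\tau$; ($\to$e) from $\Gamma\vdash t:[\sigma_i]_{i\in I}\to\tau$ and $(\Delta_i\vdash u:\sigma_i)_{i\in I}$ infer $\Gamma+\sum_i\Delta_i\vdash t\,u:\tau$. Typed occurrences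 $\mathrm{toc}(\Phi)$: if the last rule is (ax) or (val), $\{\epsilon\}$; if ($\to$i) with premise $\Phi_t$, $\{\epsilon\}\cup 0\cdot\mathrm{toc}(\Phi_t)$; if ($\to$e) with premises $\Phi_t$ and $(\Phi_u^i)_{i\in I}$, $\{\epsilon\}\cup 0\cdot\mathrm{toc}(\Phi_t)\cup\bigcup_{i\in I}1\cdot\mathrm{toc}(\Phi_u^i)$. -}

module Defs where

open import Data.Nat using (ℕ; zero; suc; _+_; compare; less; equal; greater)
open import Data.Nat.Properties using (_≟_)
open import Data.List using (List; []; _∷_; _++_)
open import Data.Maybe using (Maybe; just; nothing)
open import Data.Product using (Σ; ∃; ∃-syntax; _×_; _,_)
open import Relation.Nullary using (¬_; yes; no)
open import Relation.Binary.PropositionalEquality using (_≡_)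

data Tm : Set where
  var : ℕ → Tm
  app : Tm → Tm → Tm
  lam : Tm → Tm

shift : ℕ → Tm → Tm
shift c (var x) with compare x c
... | less _ _    = var x
... | equal _     = var (suc x)
... | greater _ _ = var (suc x)
shift c (app a b) = app (shift c a) (shift c b)
shift c (lam a)   = lam (shift (suc c) a)

shiftN : ℕ → Tm → Tm
shiftN zero    v = v
shiftN (suc n) v = shift 0 (shiftN n v)

-- capture-avoiding substitution of v for variable k (and lowering the
-- variables above k, since the binder of k disappears)
sub : ℕ → Tm → Tm → Tm
sub k v (var x) with compare x k
... | less _ _      = var x
... | equal _       = shiftN k v
... | greater _ x'  = var (k + x')
sub k v (app a b) = app (sub k v a) (sub k v b)
sub k v (lam a)   = lam (sub (suc k) v a)

_[_] : Tm → Tm → Tm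
s [ v ] = sub 0 v s

data Dir : Set where
  d0 d1 : Dir

Pos : Set
Pos = List Dir

_at_ : Tm → Pos → Maybe Tm
t         at []       = just t
app a b   at (d0 ∷ p) = a at p
app a b   at (d1 ∷ p) = b at p
lam a     at (d0 ∷ p) = a at p
lam a     at (d1 ∷ p) = nothing
var x     at (_ ∷ p)  = nothing

_∈oc_ : Pos → Tm → Set
p ∈oc t = ∃[ s ] (t at p ≡ just s)

RedexOcc : Tm → Pos → Set
RedexOcc t p = ∃[ s ] ∃[ v ] (t at p ≡ just (app (lam s) v))

_≼_ : Pos → Pos → Set
p ≼ q = ∃[ w ] (q ≡ p ++ w)

data _⟶[_]_ : Tm → Pos → Tm → Set where
  β    : ∀ {s v} → app (lam s) v ⟶[ [] ] (s [ v ])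
  appL : ∀ {a a' b p} → a ⟶[ p ] a' → app a b ⟶[ d0 ∷ p ] app a' b
  appR : ∀ {a b b' p} → b ⟶[ p ] b' → app a b ⟶[ d1 ∷ p ] app a b'
  lamC : ∀ {a a' p} → a ⟶[ p ] a' → lam a ⟶[ d0 ∷ p ] lam a'

data _↠_ : Tm → Tm → Set where
  done : ∀ {t} → t ↠ t
  step : ∀ {t t' u p} → t ⟶[ p ] t' → t' ↠ u → t ↠ u

-- BoundOcc s k w : w is an occurrence in s of the variable with index k
-- (counted from outside s), i.e. of the variable bound by the binder just
-- above s when k = 0.
data BoundOcc : Tm → ℕ → Pos → Set where
  here  : ∀ {k} → BoundOcc (var k) k []
  inL   : ∀ {a b k w} → BoundOcc a k w → BoundOcc (app a b) k (d0 ∷ w)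
  inR   : ∀ {a b k w} → BoundOcc b k w → BoundOcc (app a b) k (d1 ∷ w)
  inLam : ∀ {a k w} → BoundOcc a (suc k) w → BoundOcc (lam a) k (d0 ∷ w)

data Res (t : Tm) (p : Pos) : Pos → Pos → Set where
  out  : ∀ {q} → ¬ (p ≼ q) → Res t p q q
  body : ∀ {s v w} → t at p ≡ just (app (lam s) v) →
         Res t p (p ++ d0 ∷ d0 ∷ w) (p ++ w)
  arg  : ∀ {s v w w'} → t at p ≡ just (app (lam s) v) → BoundOcc s 0 w' →
         Res t p (p ++ d1 ∷ w) (p ++ w' ++ w)

data Used : ∀ {t u} → t ↠ u → Pos → Set where
  here  : ∀ {t t' u p} {st : t ⟶[ p ] t'} {ρ : t' ↠ u} → Used (step st ρ) p
  there : ∀ {t t' u p q q'} {st : t ⟶[ p ] t'} {ρ : t' ↠ u} →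
          Res t p q q' → Used ρ q' → Used (step st ρ) q

data Neutral : Tm → Set where
  var : ∀ {x} → Neutral (var x)
  app : ∀ {t u} → Neutral t → Neutral (app t u)

data WHNF : Tm → Set where
  lam     : ∀ {t} → WHNF (lam t)
  neutral : ∀ {t} → Neutral t → WHNF t

WHNeeded : Tm → Pos → Set
WHNeeded t r = RedexOcc t r × (∀ {u} (ρ : t ↠ u) → WHNF u → Used ρ r)

-- types; multisets are represented by lists, compared up to ≈M below
data Ty : Set where
  𝕒    : Ty
  tvar : ℕ → Ty
  _⇒_  : List Ty → Ty → Ty

mutual
  data _≈T_ : Ty → Ty → Set where
    𝕒≈   : 𝕒 ≈T 𝕒
    tvar≈ : ∀ {α} → tvar α ≈T tvar α
    ⇒≈   : ∀ {M N τ ρ} → M ≈M N → τ ≈T ρ → (M ⇒ τ) ≈T (N ⇒ ρ)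

  data _≈M_ : List Ty → List Ty → Set where
    []≈  : [] ≈M []
    cons≈ : ∀ {x y xs ys₁ ys₂} → x ≈T y → xs ≈M (ys₁ ++ ys₂) →
            (x ∷ xs) ≈M (ys₁ ++ y ∷ ys₂)

Ctx : Set
Ctx = ℕ → List Ty

∅C : Ctx
∅C _ = []

[_∶_] : ℕ → Ty → Ctx
[ x ∶ τ ] y with y ≟ x
... | yes _ = τ ∷ []
... | no _  = []

_+C_ : Ctx → Ctx → Ctx
(Γ +C Δ) x = Γ x ++ Δ x

-- Γ \ x for the bound variable (index 0): remove it and shift down
dropC : Ctx → Ctx
dropC Γ x = Γ (suc x)

mutual
  data _⊢_∶_ : Ctx → Tm → Ty → Set where
    ax  : ∀ {x τ} → [ x ∶ τ ] ⊢ var x ∶ τ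
    val : ∀ {t} → ∅C ⊢ lam t ∶ 𝕒
    ⇒i  : ∀ {Γ t τ} → Γ ⊢ t ∶ τ → dropC Γ ⊢ lam t ∶ (Γ 0 ⇒ τ)
    ⇒e  : ∀ {Γ Δ t u M τ σs} → Γ ⊢ t ∶ (M ⇒ τ) → Args Δ u σs → σs ≈M M →
          (Γ +C Δ) ⊢ app t u ∶ τ

  -- the family of premises (Δᵢ ⊢ u : σᵢ)_{i∈I}; the context is ΣΔᵢ
  data Args : Ctx → Tm → List Ty → Set where
    []  : ∀ {u} → Args ∅C u []
    _∷_ : ∀ {Δ Δs u σ σs} → Δ ⊢ u ∶ σ → Args Δs u σs → Args (Δ +C Δs) u (σ ∷ σs)

mutual
  data _∈toc_ : ∀ {Γ t τ} → Pos → Γ ⊢ t ∶ τ → Set where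
    root : ∀ {Γ t τ} {Φ : Γ ⊢ t ∶ τ} → [] ∈toc Φ
    inλ  : ∀ {Γ t τ p} {Φ : Γ ⊢ t ∶ τ} → p ∈toc Φ → (d0 ∷ p) ∈toc ⇒i Φ
    inFn : ∀ {Γ Δ t u M τ σs p} {Φ : Γ ⊢ t ∶ (M ⇒ τ)} {Ψ : Args Δ u σs}
             {e : σs ≈M M} → p ∈toc Φ → (d0 ∷ p) ∈toc ⇒e Φ Ψ e
    inArg : ∀ {Γ Δ t u M τ σs p} {Φ : Γ ⊢ t ∶ (M ⇒ τ)} {Ψ : Args Δ u σs}
             {e : σs ≈M M} → p ∈tocArgs Ψ → (d1 ∷ p) ∈toc ⇒e Φ Ψ e

  data _∈tocArgs_ : ∀ {Δ u σs} → Pos → Args Δ u σs → Set where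
    hd : ∀ {Δ Δs u σ σs p} {Φ : Δ ⊢ u ∶ σ} {Ψ : Args Δs u σs} →
         p ∈toc Φ → p ∈tocArgs (Φ ∷ Ψ)
    tl : ∀ {Δ Δs u σ σs p} {Φ : Δ ⊢ u ∶ σ} {Ψ : Args Δs u σs} →
         p ∈tocArgs Ψ → p ∈tocArgs (Φ ∷ Ψ)

module Submission where

-- Contracting the head redex of a typed term yields a
-- derivation of the reduct with strictly fewer rules (the argument derivations are
-- distributed over the occurrences of the bound variable, one per occurrence), so head
-- reduction from a typable term reaches a WHNF, and every head redex it contracts is a
-- typed occurrence.  Moreover every typed occurrence of s[v] is traced back to a typed
-- occurrence of s or of v, so a residual that is typed after the step comes from an
-- occurrence typed before it.  Hence every redex used by this head reduction, in
-- particular every weak-head needed one, is typed in the original derivation.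

open import Defs
open import Data.Nat using (ℕ; zero; suc; _+_; _≤_; _<_; z≤n; s≤s; compare; less; equal; greater)
open import Data.Nat.Properties
open import Data.Nat.Induction using (<-wellFounded)
open import Algebra.Properties.CommutativeSemigroup +-commutativeSemigroup using (interchange; x∙yz≈y∙xz)
open import Data.List using (List; []; _∷_; _++_)
open import Data.List.Properties using (++-assoc; ++-identityʳ; ∷-injective; ∷-injectiveʳ)
open import Data.List.Relation.Binary.Pointwise using (Pointwise; []; _∷_; ++⁺)
open import Data.Maybe using (just)
open import Data.Product using (∃-syntax; _×_; _,_; proj₂; map₁; map₂)
open import Data.Sum using (_⊎_; inj₁; inj₂)
import Data.Sum as Sum
open import Data.Empty using (⊥-elim)
open import Function using (id; _∘_)
open import Induction.WellFounded using (Acc; acc)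
open import Relation.Nullary using (¬_; Dec; yes; no)
open import Relation.Unary using (_⊆_)
open import Relation.Binary.PropositionalEquality hiding ([_])

mutual
  ≈T-refl : ∀ {τ} → τ ≈T τ
  ≈T-refl {𝕒}      = 𝕒≈
  ≈T-refl {tvar _} = tvar≈
  ≈T-refl {_ ⇒ _}  = ⇒≈ ≈M-refl ≈T-refl

  ≈M-refl : ∀ {M} → M ≈M M
  ≈M-refl {[]}    = []≈
  ≈M-refl {_ ∷ _} = cons≈ {ys₁ = []} ≈T-refl ≈M-refl

≈M-insert : ∀ xs₁ {xs₂ ys x y} → (xs₁ ++ xs₂) ≈M ys → x ≈T y → (xs₁ ++ x ∷ xs₂) ≈M (y ∷ ys)
≈M-insert []        xs≈ys x≈y = cons≈ {ys₁ = []} x≈y xs≈ys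
≈M-insert (_ ∷ xs₁) (cons≈ {ys₁ = ys₁} x≈y xs≈ys) x′≈y′ =
  cons≈ {ys₁ = _ ∷ ys₁} x≈y (≈M-insert xs₁ xs≈ys x′≈y′)

mutual
  ≈T-sym : ∀ {σ τ} → σ ≈T τ → τ ≈T σ
  ≈T-sym 𝕒≈           = 𝕒≈
  ≈T-sym tvar≈         = tvar≈
  ≈T-sym (⇒≈ M≈N σ≈τ) = ⇒≈ (≈M-sym M≈N) (≈T-sym σ≈τ)

  ≈M-sym : ∀ {M N} → M ≈M N → N ≈M M
  ≈M-sym []≈                           = []≈
  ≈M-sym (cons≈ {ys₁ = ys₁} x≈y xs≈ys) = ≈M-insert ys₁ (≈M-sym xs≈ys) (≈T-sym x≈y)

++≡++∷-split : ∀ {A : Set} (as : List A) {bs cs z ds} → as ++ bs ≡ cs ++ z ∷ ds →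
               (∃[ es ] as ≡ cs ++ z ∷ es × ds ≡ es ++ bs) ⊎
               (∃[ es ] cs ≡ as ++ es × bs ≡ es ++ z ∷ ds)
++≡++∷-split []       eq = inj₂ (_ , refl , eq)
++≡++∷-split (a ∷ as) {cs = []}    refl = inj₁ (as , refl , refl)
++≡++∷-split (a ∷ as) {cs = c ∷ cs} eq with ∷-injective eq
... | refl , eq′ = Sum.map (map₂ (map₁ (cong (a ∷_)))) (map₂ (map₁ (cong (a ∷_))))
                           (++≡++∷-split as eq′)

record Removal (y : Ty) (rest zs : List Ty) : Set where
  constructor removal
  field
    {zs₁ zs₂} : List Ty
    {z}       : Ty
    split     : zs ≡ zs₁ ++ z ∷ zs₂
    y≈z       : y ≈T z
    rest≈     : rest ≈M (zs₁ ++ zs₂)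

≈M-remove : ∀ ys₁ {y ys₂ zs} → (ys₁ ++ y ∷ ys₂) ≈M zs → Removal y (ys₁ ++ ys₂) zs
≈M-remove []        (cons≈ y≈z rest≈) = removal refl y≈z rest≈
≈M-remove (h ∷ ys₁) {ys₂ = ys₂} (cons≈ {y = k} {ys₁ = as} {ys₂ = bs} h≈k rest≈)
  with ≈M-remove ys₁ rest≈
... | removal {cs} {ds} {z} eq y≈z rest≈′ with ++≡++∷-split as eq
...   | inj₁ (es , refl , refl) =
  removal (++-assoc cs (z ∷ es) (k ∷ bs)) y≈z
    (subst ((h ∷ ys₁ ++ ys₂) ≈M_) (++-assoc cs es (k ∷ bs))
      (cons≈ {ys₁ = cs ++ es} h≈k (subst ((ys₁ ++ ys₂) ≈M_) (sym (++-assoc cs es bs)) rest≈′)))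
...   | inj₂ (es , refl , refl) =
  removal (sym (++-assoc as (k ∷ es) (z ∷ ds))) y≈z
    (subst ((h ∷ ys₁ ++ ys₂) ≈M_) (sym (++-assoc as (k ∷ es) ds))
      (cons≈ {ys₁ = as} h≈k (subst ((ys₁ ++ ys₂) ≈M_) (++-assoc as es ds) rest≈′)))

mutual
  ≈T-trans : ∀ {ρ σ τ} → ρ ≈T σ → σ ≈T τ → ρ ≈T τ
  ≈T-trans 𝕒≈           𝕒≈           = 𝕒≈
  ≈T-trans tvar≈         tvar≈         = tvar≈
  ≈T-trans (⇒≈ L≈M ρ≈σ) (⇒≈ M≈N σ≈τ) = ⇒≈ (≈M-trans L≈M M≈N) (≈T-trans ρ≈σ σ≈τ)

  ≈M-trans : ∀ {L M N} → L ≈M M → M ≈M N → L ≈M N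
  ≈M-trans []≈ M≈N = M≈N
  ≈M-trans (cons≈ {ys₁ = ys₁} x≈y xs≈ys) M≈N with ≈M-remove ys₁ M≈N
  ... | removal refl y≈z rest≈ = cons≈ (≈T-trans x≈y y≈z) (≈M-trans xs≈ys rest≈)

Pointwise⇒≈M : ∀ {M N} → Pointwise _≈T_ M N → M ≈M N
Pointwise⇒≈M []           = []≈
Pointwise⇒≈M (x≈y ∷ M≈N) = cons≈ {ys₁ = []} x≈y (Pointwise⇒≈M M≈N)

mutual
  size : ∀ {Γ t τ} → Γ ⊢ t ∶ τ → ℕ
  size ax         = 1
  size val        = 1
  size (⇒i Φ)     = suc (size Φ)
  size (⇒e Φ Ψ _) = suc (size Φ + sizeArgs Ψ)

  sizeArgs : ∀ {Δ u σs} → Args Δ u σs → ℕ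
  sizeArgs []      = 0
  sizeArgs (Φ ∷ Ψ) = size Φ + sizeArgs Ψ

record ArgsSplit {Δ u σs} (Ψ : Args Δ u σs) (M N : List Ty) : Set where
  constructor argsSplit
  field
    {Δ₁ Δ₂}    : Ctx
    {σs₁ σs₂}  : List Ty
    Ψ₁         : Args Δ₁ u σs₁
    Ψ₂         : Args Δ₂ u σs₂
    σs₁≈M      : Pointwise _≈T_ σs₁ M
    σs₂≈N      : Pointwise _≈T_ σs₂ N
    size-split : sizeArgs Ψ ≡ sizeArgs Ψ₁ + sizeArgs Ψ₂
    toc₁       : ∀ {w} → w ∈tocArgs Ψ₁ → w ∈tocArgs Ψ
    toc₂       : ∀ {w} → w ∈tocArgs Ψ₂ → w ∈tocArgs Ψ

splitArgs : ∀ M {N Δ u σs} (Ψ : Args Δ u σs) → Pointwise _≈T_ σs (M ++ N) → ArgsSplit Ψ M N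
splitArgs []      Ψ       σs≈ = argsSplit [] Ψ [] σs≈ refl (λ ()) id
splitArgs (_ ∷ M) (Φ ∷ Ψ) (σ≈ ∷ σs≈) with splitArgs M Ψ σs≈
... | argsSplit Ψ₁ Ψ₂ σs₁≈ σs₂≈ size-split toc₁ toc₂ =
  argsSplit (Φ ∷ Ψ₁) Ψ₂ (σ≈ ∷ σs₁≈) σs₂≈
    (trans (cong (size Φ +_) size-split) (sym (+-assoc (size Φ) (sizeArgs Ψ₁) (sizeArgs Ψ₂))))
    (λ { (hd x) → hd x ; (tl x) → tl (toc₁ x) }) (tl ∘ toc₂)

record ArgsAppend {Δ₁ Δ₂ u σs₁ σs₂} (Ψ₁ : Args Δ₁ u σs₁) (Ψ₂ : Args Δ₂ u σs₂) : Set where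
  constructor argsAppend
  field
    {Δ}         : Ctx
    Ψ           : Args Δ u (σs₁ ++ σs₂)
    size-append : sizeArgs Ψ ≡ sizeArgs Ψ₁ + sizeArgs Ψ₂
    toc-append  : ∀ {w} → w ∈tocArgs Ψ → w ∈tocArgs Ψ₁ ⊎ w ∈tocArgs Ψ₂

appendArgs : ∀ {Δ₁ Δ₂ u σs₁ σs₂} (Ψ₁ : Args Δ₁ u σs₁) (Ψ₂ : Args Δ₂ u σs₂) → ArgsAppend Ψ₁ Ψ₂
appendArgs []       Ψ₂ = argsAppend Ψ₂ refl inj₂
appendArgs (Φ ∷ Ψ₁) Ψ₂ with appendArgs Ψ₁ Ψ₂
... | argsAppend Ψ size-append toc-append =
  argsAppend (Φ ∷ Ψ)
    (trans (cong (size Φ +_) size-append) (sym (+-assoc (size Φ) (sizeArgs Ψ₁) (sizeArgs Ψ₂))))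
    (λ { (hd x) → inj₁ (hd x) ; (tl x) → Sum.map₁ tl (toc-append x) })

record ArgsPermutation {Δ u σs} (Ψ : Args Δ u σs) (M : List Ty) : Set where
  constructor argsPermutation
  field
    {Δ′}      : Ctx
    {σs′}     : List Ty
    Ψ′        : Args Δ′ u σs′
    σs′≈M     : Pointwise _≈T_ σs′ M
    size-perm : sizeArgs Ψ′ ≡ sizeArgs Ψ
    toc-perm  : ∀ {w} → w ∈tocArgs Ψ′ → w ∈tocArgs Ψ

permuteArgs : ∀ {M Δ u σs} (Ψ : Args Δ u σs) → σs ≈M M → ArgsPermutation Ψ M
permuteArgs []      []≈ = argsPermutation [] [] refl (λ ())
permuteArgs (Φ ∷ Ψ) (cons≈ {ys₁ = M₁} σ≈ σs≈) with permuteArgs Ψ σs≈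
... | argsPermutation Ψ′ σs′≈ size-perm toc-perm with splitArgs M₁ Ψ′ σs′≈
...   | argsSplit Ψ₁ Ψ₂ σs₁≈ σs₂≈ size-split toc₁ toc₂ with appendArgs Ψ₁ (Φ ∷ Ψ₂)
...     | argsAppend Ψ″ size-append toc-append =
  argsPermutation Ψ″ (++⁺ σs₁≈ (σ≈ ∷ σs₂≈)) size″ toc″
  where
    open ≡-Reasoning
    size″ : sizeArgs Ψ″ ≡ size Φ + sizeArgs Ψ
    size″ = begin
      sizeArgs Ψ″                          ≡⟨ size-append ⟩
      sizeArgs Ψ₁ + (size Φ + sizeArgs Ψ₂) ≡⟨ x∙yz≈y∙xz (sizeArgs Ψ₁) (size Φ) (sizeArgs Ψ₂) ⟩
      size Φ + (sizeArgs Ψ₁ + sizeArgs Ψ₂) ≡⟨ cong (size Φ +_) (trans (sym size-split) size-perm) ⟩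
      size Φ + sizeArgs Ψ                  ∎
    toc″ : ∀ {w} → w ∈tocArgs Ψ″ → w ∈tocArgs (Φ ∷ Ψ)
    toc″ x with toc-append x
    ... | inj₁ y      = tl (toc-perm (toc₁ y))
    ... | inj₂ (hd y) = hd y
    ... | inj₂ (tl y) = tl (toc-perm (toc₂ y))

[∶]-self : ∀ x τ → [ x ∶ τ ] x ≡ τ ∷ []
[∶]-self x τ with x ≟ x
... | yes _    = refl
... | no x≢x = ⊥-elim (x≢x refl)

[∶]-other : ∀ {x y} τ → y ≢ x → [ x ∶ τ ] y ≡ []
[∶]-other {x} {y} τ y≢x with y ≟ x
... | yes y≡x = ⊥-elim (y≢x y≡x)
... | no _    = refl

[∶]-suc : ∀ x y τ → [ suc x ∶ τ ] (suc y) ≡ [ x ∶ τ ] y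
[∶]-suc x y τ = by-cases (y ≟ x)
  where
    by-cases : Dec (y ≡ x) → [ suc x ∶ τ ] (suc y) ≡ [ x ∶ τ ] y
    by-cases (yes refl) = trans ([∶]-self (suc x) τ) (sym ([∶]-self x τ))
    by-cases (no y≢x)   = trans ([∶]-other τ (y≢x ∘ suc-injective)) (sym ([∶]-other τ y≢x))

record ShiftedCtx (c : ℕ) (Δ Δ′ : Ctx) : Set where
  constructor shiftedCtx
  field
    below : ∀ y → y < c → Δ′ y ≡ Δ y
    at-c  : Δ′ c ≡ []
    above : ∀ y → c ≤ y → Δ′ (suc y) ≡ Δ y

shiftedCtx-∅ : ∀ {c} → ShiftedCtx c ∅C ∅C
shiftedCtx-∅ = shiftedCtx (λ _ _ → refl) refl (λ _ _ → refl)

shiftedCtx-+C : ∀ {c Δ₁ Δ₁′ Δ₂ Δ₂′} → ShiftedCtx c Δ₁ Δ₁′ → ShiftedCtx c Δ₂ Δ₂′ →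
                ShiftedCtx c (Δ₁ +C Δ₂) (Δ₁′ +C Δ₂′)
shiftedCtx-+C (shiftedCtx b₁ a₁ g₁) (shiftedCtx b₂ a₂ g₂) =
  shiftedCtx (λ y y<c → cong₂ _++_ (b₁ y y<c) (b₂ y y<c)) (cong₂ _++_ a₁ a₂)
             (λ y c≤y → cong₂ _++_ (g₁ y c≤y) (g₂ y c≤y))

shiftedCtx-drop : ∀ {c Δ Δ′} → ShiftedCtx (suc c) Δ Δ′ → ShiftedCtx c (dropC Δ) (dropC Δ′)
shiftedCtx-drop (shiftedCtx b a g) =
  shiftedCtx (λ y y<c → b (suc y) (s≤s y<c)) a (λ y c≤y → g (suc y) (s≤s c≤y))

shiftedCtx-below : ∀ {c x} τ → x < c → ShiftedCtx c [ x ∶ τ ] [ x ∶ τ ]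
shiftedCtx-below τ x<c =
  shiftedCtx (λ _ _ → refl) ([∶]-other τ (>⇒≢ x<c))
    (λ y c≤y → trans ([∶]-other τ (>⇒≢ (<-≤-trans x<c (m≤n⇒m≤1+n c≤y))))
                     (sym ([∶]-other τ (>⇒≢ (<-≤-trans x<c c≤y)))))

shiftedCtx-above : ∀ {c x} τ → c ≤ x → ShiftedCtx c [ x ∶ τ ] [ suc x ∶ τ ]
shiftedCtx-above {x = x} τ c≤x =
  shiftedCtx (λ y y<c → trans ([∶]-other τ (<⇒≢ (<-≤-trans y<c (m≤n⇒m≤1+n c≤x))))
                              (sym ([∶]-other τ (<⇒≢ (<-≤-trans y<c c≤x)))))
             ([∶]-other τ (<⇒≢ (s≤s c≤x))) (λ y _ → [∶]-suc x y τ)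

retype : ∀ {Γ t σ τ} → σ ≡ τ → Γ ⊢ t ∶ σ → Γ ⊢ t ∶ τ
retype refl Φ = Φ

size-retype : ∀ {Γ t σ τ} (σ≡τ : σ ≡ τ) (Φ : Γ ⊢ t ∶ σ) → size (retype σ≡τ Φ) ≡ size Φ
size-retype refl Φ = refl

toc-retype : ∀ {Γ t σ τ w} (σ≡τ : σ ≡ τ) (Φ : Γ ⊢ t ∶ σ) → w ∈toc retype σ≡τ Φ → w ∈toc Φ
toc-retype refl Φ w∈ = w∈

record ShiftedDerivation (c : ℕ) {Δ t σ} (Φ : Δ ⊢ t ∶ σ) (t′ : Tm) : Set where
  constructor shifted
  field
    {Δ′}       : Ctx
    Φ′         : Δ′ ⊢ t′ ∶ σ
    ctx        : ShiftedCtx c Δ Δ′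
    size-shift : size Φ′ ≡ size Φ
    toc-shift  : ∀ {w} → w ∈toc Φ′ → w ∈toc Φ

record ShiftedArgs (c : ℕ) {Δ u σs} (Ψ : Args Δ u σs) (u′ : Tm) : Set where
  constructor shiftedArgs
  field
    {Δ′}       : Ctx
    Ψ′         : Args Δ′ u′ σs
    ctx        : ShiftedCtx c Δ Δ′
    size-shift : sizeArgs Ψ′ ≡ sizeArgs Ψ
    toc-shift  : ∀ {w} → w ∈tocArgs Ψ′ → w ∈tocArgs Ψ

toc-ax : ∀ {x y σ τ w} → w ∈toc ax {x} {σ} → w ∈toc ax {y} {τ}
toc-ax root = root

mutual
  shiftDerivation : ∀ c {Δ t σ} (Φ : Δ ⊢ t ∶ σ) → ShiftedDerivation c Φ (shift c t)
  shiftDerivation c (ax {x} {τ}) with compare x c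
  ... | less _ _    = shifted ax (shiftedCtx-below τ (s≤s (m≤m+n x _))) refl id
  ... | equal _     = shifted ax (shiftedCtx-above τ ≤-refl) refl toc-ax
  ... | greater _ _ = shifted ax (shiftedCtx-above τ (m≤n⇒m≤1+n (m≤m+n c _))) refl toc-ax
  shiftDerivation c val = shifted val shiftedCtx-∅ refl λ { root → root }
  shiftDerivation c (⇒i {τ = τ} Φ) with shiftDerivation (suc c) Φ
  ... | shifted Φ′ ctx size-shift toc-shift =
    shifted (retype same-type (⇒i Φ′)) (shiftedCtx-drop ctx)
      (trans (size-retype same-type (⇒i Φ′)) (cong suc size-shift))
      (toc-λ ∘ toc-retype same-type (⇒i Φ′))
    where
      same-type = cong (_⇒ τ) (ShiftedCtx.below ctx 0 (s≤s z≤n))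
      toc-λ : ∀ {w} → w ∈toc ⇒i Φ′ → w ∈toc ⇒i Φ
      toc-λ root    = root
      toc-λ (inλ x) = inλ (toc-shift x)
  shiftDerivation c (⇒e Φ Ψ e) with shiftDerivation c Φ | shiftArgs c Ψ
  ... | shifted Φ′ ctx₁ size₁ toc₁ | shiftedArgs Ψ′ ctx₂ size₂ toc₂ =
    shifted (⇒e Φ′ Ψ′ e) (shiftedCtx-+C ctx₁ ctx₂) (cong suc (cong₂ _+_ size₁ size₂))
      (λ { root → root ; (inFn x) → inFn (toc₁ x) ; (inArg x) → inArg (toc₂ x) })

  shiftArgs : ∀ c {Δ u σs} (Ψ : Args Δ u σs) → ShiftedArgs c Ψ (shift c u)
  shiftArgs c [] = shiftedArgs [] shiftedCtx-∅ refl λ ()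
  shiftArgs c (Φ ∷ Ψ) with shiftDerivation c Φ | shiftArgs c Ψ
  ... | shifted Φ′ ctx₁ size₁ toc₁ | shiftedArgs Ψ′ ctx₂ size₂ toc₂ =
    shiftedArgs (Φ′ ∷ Ψ′) (shiftedCtx-+C ctx₁ ctx₂) (cong₂ _+_ size₁ size₂)
      (λ { (hd x) → hd (toc₁ x) ; (tl x) → tl (toc₂ x) })

record WeakenedDerivation (k : ℕ) {Δ t σ} (Φ : Δ ⊢ t ∶ σ) : Set where
  constructor weakened
  field
    {Δ′}        : Ctx
    Φ′          : Δ′ ⊢ shiftN k t ∶ σ
    fresh       : ∀ y → y < k → Δ′ y ≡ []
    size-weaken : size Φ′ ≡ size Φ
    toc-weaken  : ∀ {w} → w ∈toc Φ′ → w ∈toc Φ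

weakenDerivation : ∀ k {Δ t σ} (Φ : Δ ⊢ t ∶ σ) → WeakenedDerivation k Φ
weakenDerivation zero    Φ = weakened Φ (λ _ ()) refl id
weakenDerivation (suc k) Φ with weakenDerivation k Φ
... | weakened Φ₁ fresh size₁ toc₁ with shiftDerivation 0 Φ₁
...   | shifted {Δ₂} Φ₂ (shiftedCtx _ at-0 above) size₂ toc₂ =
  weakened Φ₂ fresh′ (trans size₂ size₁) (toc₁ ∘ toc₂)
  where
    fresh′ : ∀ y → y < suc k → Δ₂ y ≡ []
    fresh′ zero    _         = at-0
    fresh′ (suc y) (s≤s y<k) = trans (above y z≤n) (fresh y y<k)

∈oc-shift : ∀ c t {w} → w ∈oc t → w ∈oc shift c t
∈oc-shift c t         {[]}     _       = _ , refl
∈oc-shift c (var x)   {_ ∷ _}  (_ , ())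
∈oc-shift c (app a b) {d0 ∷ w} w∈     = ∈oc-shift c a {w} w∈
∈oc-shift c (app a b) {d1 ∷ w} w∈     = ∈oc-shift c b {w} w∈
∈oc-shift c (lam a)   {d0 ∷ w} w∈     = ∈oc-shift (suc c) a {w} w∈
∈oc-shift c (lam a)   {d1 ∷ w} (_ , ())

∈oc-shiftN : ∀ n t {w} → w ∈oc t → w ∈oc shiftN n t
∈oc-shiftN zero    t     w∈ = w∈
∈oc-shiftN (suc n) t {w} w∈ = ∈oc-shift 0 (shiftN n t) {w} (∈oc-shiftN n t {w} w∈)

∈oc-sub : ∀ k v s {w} → w ∈oc s → w ∈oc sub k v s
∈oc-sub k v s         {[]}     _       = _ , refl
∈oc-sub k v (var x)   {_ ∷ _}  (_ , ())
∈oc-sub k v (app a b) {d0 ∷ w} w∈     = ∈oc-sub k v a {w} w∈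
∈oc-sub k v (app a b) {d1 ∷ w} w∈     = ∈oc-sub k v b {w} w∈
∈oc-sub k v (lam a)   {d0 ∷ w} w∈     = ∈oc-sub (suc k) v a {w} w∈
∈oc-sub k v (lam a)   {d1 ∷ w} (_ , ())

at-++ : ∀ t p w {u} → t at p ≡ just u → t at (p ++ w) ≡ u at w
at-++ t         []       w refl = refl
at-++ (var x)   (_ ∷ p)  w ()
at-++ (app a b) (d0 ∷ p) w eq = at-++ a p w eq
at-++ (app a b) (d1 ∷ p) w eq = at-++ b p w eq
at-++ (lam a)   (d0 ∷ p) w eq = at-++ a p w eq
at-++ (lam a)   (d1 ∷ p) w ()

sub-var-self : ∀ k v x → x ≡ k → sub k v (var x) ≡ shiftN k v
sub-var-self k v x x≡k with compare x k
... | less _ m    = ⊥-elim (m≢1+m+n x x≡k)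
... | equal _     = refl
... | greater _ m = ⊥-elim (m≢1+m+n k (sym x≡k))

at-sub-BoundOcc : ∀ {s k w} v → BoundOcc s k w → ∃[ n ] sub k v s at w ≡ just (shiftN n v)
at-sub-BoundOcc {k = k} v here = k , cong just (sub-var-self k v k refl)
at-sub-BoundOcc v (inL b)   = at-sub-BoundOcc v b
at-sub-BoundOcc v (inR b)   = at-sub-BoundOcc v b
at-sub-BoundOcc v (inLam b) = at-sub-BoundOcc v b

BoundOcc-var : ∀ {x k w} → BoundOcc (var x) k w → x ≡ k
BoundOcc-var here = refl

BoundOcc-maximal : ∀ {s k w} w₂ → BoundOcc s k w → (w ++ w₂) ∈oc s → w₂ ≡ []
BoundOcc-maximal []      here      _   = refl
BoundOcc-maximal (_ ∷ _) here      (_ , ())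
BoundOcc-maximal w₂      (inL b)   w∈ = BoundOcc-maximal w₂ b w∈
BoundOcc-maximal w₂      (inR b)   w∈ = BoundOcc-maximal w₂ b w∈
BoundOcc-maximal w₂      (inLam b) w∈ = BoundOcc-maximal w₂ b w∈

BoundOcc-++-cancel : ∀ {s k w₁ w₂} {x y : Pos} → BoundOcc s k w₁ → BoundOcc s k w₂ →
                     w₁ ++ x ≡ w₂ ++ y → x ≡ y
BoundOcc-++-cancel here       here       eq = eq
BoundOcc-++-cancel (inL b₁)   (inL b₂)   eq = BoundOcc-++-cancel b₁ b₂ (∷-injectiveʳ eq)
BoundOcc-++-cancel (inR b₁)   (inR b₂)   eq = BoundOcc-++-cancel b₁ b₂ (∷-injectiveʳ eq)
BoundOcc-++-cancel (inLam b₁) (inLam b₂) eq = BoundOcc-++-cancel b₁ b₂ (∷-injectiveʳ eq)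
BoundOcc-++-cancel (inL _)    (inR _)    ()
BoundOcc-++-cancel (inR _)    (inL _)    ()

NoBoundPrefix : Tm → ℕ → Pos → Set
NoBoundPrefix s k w = ∀ {w₁} → BoundOcc s k w₁ → ¬ (w₁ ≼ w)

noBoundPrefix-[] : ∀ {s k} → ¬ BoundOcc s k [] → NoBoundPrefix s k []
noBoundPrefix-[] ¬b {[]}    b _        = ¬b b
noBoundPrefix-[] ¬b {_ ∷ _} _ (_ , ())

-- The origin of an occurrence w of sub k v s: an occurrence of s itself, or an
-- occurrence w₂ of the copy of v substituted at an occurrence w₁ of the variable k.
-- P and Q are read as "typed in the derivation of s", resp. "of v".
data SubstTrace (P Q : Pos → Set) (s : Tm) (k : ℕ) (w : Pos) : Set where
  fromBody : P w → NoBoundPrefix s k w → SubstTrace P Q s k w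
  fromArg  : ∀ {w₁ w₂} → w ≡ w₁ ++ w₂ → BoundOcc s k w₁ → P w₁ → Q w₂ → SubstTrace P Q s k w

trace-map : ∀ {P P′ Q Q′ s k w} → P ⊆ P′ → Q ⊆ Q′ → SubstTrace P Q s k w → SubstTrace P′ Q′ s k w
trace-map f g (fromBody x nb)    = fromBody (f x) nb
trace-map f g (fromArg eq b x y) = fromArg eq b (f x) (g y)

trace-under : ∀ {P P′ Q Q′ s s′ k k′ d w} →
              (∀ {w} → BoundOcc s′ k′ w → BoundOcc s k (d ∷ w)) →
              (∀ {w} → BoundOcc s k (d ∷ w) → BoundOcc s′ k′ w) → ¬ BoundOcc s k [] →
              (∀ {w} → P w → P′ (d ∷ w)) → Q ⊆ Q′ →
              SubstTrace P Q s′ k′ w → SubstTrace P′ Q′ s k (d ∷ w)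
trace-under {s = s} {k = k} {d = d} {w = w} lift lower ¬b f g (fromBody x nb) = fromBody (f x) nb′
  where
    nb′ : NoBoundPrefix s k (d ∷ w)
    nb′ {[]}     b _        = ¬b b
    nb′ {_ ∷ w₁} b (z , eq) with ∷-injective eq
    ... | refl , eq′ = nb (lower b) (z , eq′)
trace-under lift lower ¬b f g (fromArg eq b x y) = fromArg (cong (_ ∷_) eq) (lift b) (f x) (g y)

trace-appL : ∀ {P P′ Q Q′ a b k w} → (∀ {w} → P w → P′ (d0 ∷ w)) → Q ⊆ Q′ →
             SubstTrace P Q a k w → SubstTrace P′ Q′ (app a b) k (d0 ∷ w)
trace-appL = trace-under inL (λ { (inL b) → b }) (λ ())

trace-appR : ∀ {P P′ Q Q′ a b k w} → (∀ {w} → P w → P′ (d1 ∷ w)) → Q ⊆ Q′ →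
             SubstTrace P Q b k w → SubstTrace P′ Q′ (app a b) k (d1 ∷ w)
trace-appR = trace-under inR (λ { (inR b) → b }) (λ ())

trace-lam : ∀ {P P′ Q Q′ a k w} → (∀ {w} → P w → P′ (d0 ∷ w)) → Q ⊆ Q′ →
            SubstTrace P Q a (suc k) w → SubstTrace P′ Q′ (lam a) k (d0 ∷ w)
trace-lam = trace-under inLam (λ { (inLam b) → b }) (λ ())

record SubstDerivation (k : ℕ) {Γ s τ} (Φ : Γ ⊢ s ∶ τ) {Δ v σs} (Ψ : Args Δ v σs) (s′ : Tm) : Set where
  constructor substituted
  field
    {Γ′}       : Ctx
    {τ′}       : Ty
    Φ′         : Γ′ ⊢ s′ ∶ τ′
    τ′≈τ       : τ′ ≈T τ
    agree      : ∀ y → y < k → Γ′ y ≡ Γ y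
    size-subst : size Φ′ ≤ size Φ + sizeArgs Ψ
    toc-subst  : ∀ {w} → w ∈toc Φ′ → SubstTrace (_∈toc Φ) (_∈tocArgs Ψ) s k w

record SubstArgs (k : ℕ) {Δ₀ u σs₀} (Ψ₀ : Args Δ₀ u σs₀) {Δ v σs} (Ψ : Args Δ v σs) (u′ : Tm) : Set where
  constructor substitutedArgs
  field
    {Δ₀′}      : Ctx
    {σs₀′}     : List Ty
    Ψ₀′        : Args Δ₀′ u′ σs₀′
    σs₀′≈σs₀   : Pointwise _≈T_ σs₀′ σs₀
    agree      : ∀ y → y < k → Δ₀′ y ≡ Δ₀ y
    size-subst : sizeArgs Ψ₀′ ≤ sizeArgs Ψ₀ + sizeArgs Ψ
    toc-subst  : ∀ {w} → w ∈tocArgs Ψ₀′ → SubstTrace (_∈tocArgs Ψ₀) (_∈tocArgs Ψ) u k w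

substBoundVar : ∀ k {v τ Δ σs} (Ψ : Args Δ v σs) → Pointwise _≈T_ σs (τ ∷ []) →
                SubstDerivation k (ax {k} {τ}) Ψ (shiftN k v)
substBoundVar k {τ = τ} (Φ ∷ _) (σ≈τ ∷ []) with weakenDerivation k Φ
... | weakened Φ′ fresh size-weaken toc-weaken =
  substituted Φ′ σ≈τ (λ y y<k → trans (fresh y y<k) (sym ([∶]-other τ (<⇒≢ y<k))))
    (≤-trans (≤-reflexive size-weaken) (≤-trans (m≤m+n _ _) (n≤1+n _)))
    (λ w∈ → fromArg refl here root (hd (toc-weaken w∈)))

+-mono-≤-interchange : ∀ a x b y {m n z} → m ≤ a + x → n ≤ b + y → z ≡ x + y → m + n ≤ (a + b) + z
+-mono-≤-interchange a x b y m≤ n≤ refl =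
  ≤-trans (+-mono-≤ m≤ n≤) (≤-reflexive (interchange a x b y))

substituted-⇒e : ∀ {k v Γ a M τ Δ₀ b σs₀ Δ σs} {Φ : Γ ⊢ a ∶ (M ⇒ τ)} {Ψ₀ : Args Δ₀ b σs₀}
                 {e : σs₀ ≈M M} {Ψ : Args Δ v σs} {N₁ N₂} (sp : ArgsSplit Ψ N₁ N₂) →
                 SubstDerivation k Φ (ArgsSplit.Ψ₁ sp) (sub k v a) →
                 SubstArgs k Ψ₀ (ArgsSplit.Ψ₂ sp) (sub k v b) →
                 SubstDerivation k (⇒e Φ Ψ₀ e) Ψ (sub k v (app a b))
substituted-⇒e {Φ = Φ} {Ψ₀} {e} (argsSplit Ψ₁ Ψ₂ _ _ size-split toc₁ toc₂)
  (substituted Φ′ (⇒≈ M≈M′ τ′≈τ) agree₁ size₁ toc₁′) (substitutedArgs Ψ₀′ σs≈ agree₂ size₂ toc₂′) =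
  substituted (⇒e Φ′ Ψ₀′ (≈M-trans (Pointwise⇒≈M σs≈) (≈M-trans e (≈M-sym M≈M′)))) τ′≈τ
    (λ y y<k → cong₂ _++_ (agree₁ y y<k) (agree₂ y y<k))
    (s≤s (+-mono-≤-interchange (size Φ) (sizeArgs Ψ₁) (sizeArgs Ψ₀) (sizeArgs Ψ₂)
                               size₁ size₂ size-split))
    λ { root       → fromBody root (noBoundPrefix-[] λ ())
      ; (inFn w∈)  → trace-appL inFn toc₁ (toc₁′ w∈)
      ; (inArg w∈) → trace-appR inArg toc₂ (toc₂′ w∈) }

substituted-∷ : ∀ {k v Δ₁ b σ Δ₀ σs₀ Δ σs} {Φ : Δ₁ ⊢ b ∶ σ} {Ψ₀ : Args Δ₀ b σs₀}
                {Ψ : Args Δ v σs} {N₁ N₂} (sp : ArgsSplit Ψ N₁ N₂) →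
                SubstDerivation k Φ (ArgsSplit.Ψ₁ sp) (sub k v b) →
                SubstArgs k Ψ₀ (ArgsSplit.Ψ₂ sp) (sub k v b) →
                SubstArgs k (Φ ∷ Ψ₀) Ψ (sub k v b)
substituted-∷ {Φ = Φ} {Ψ₀} (argsSplit Ψ₁ Ψ₂ _ _ size-split toc₁ toc₂)
  (substituted Φ′ σ′≈σ agree₁ size₁ toc₁′) (substitutedArgs Ψ₀′ σs≈ agree₂ size₂ toc₂′) =
  substitutedArgs (Φ′ ∷ Ψ₀′) (σ′≈σ ∷ σs≈) (λ y y<k → cong₂ _++_ (agree₁ y y<k) (agree₂ y y<k))
    (+-mono-≤-interchange (size Φ) (sizeArgs Ψ₁) (sizeArgs Ψ₀) (sizeArgs Ψ₂) size₁ size₂ size-split)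
    λ { (hd w∈) → trace-map hd toc₁ (toc₁′ w∈)
      ; (tl w∈) → trace-map tl toc₂ (toc₂′ w∈) }

mutual
  substDerivation : ∀ k {v Γ s τ Δ σs} (Φ : Γ ⊢ s ∶ τ) (Ψ : Args Δ v σs) →
                    Pointwise _≈T_ σs (Γ k) → SubstDerivation k Φ Ψ (sub k v s)
  substDerivation k (ax {x} {τ}) Ψ σs≈ with compare x k
  ... | less _ m =
    substituted ax ≈T-refl (λ _ _ → refl) (s≤s z≤n)
      λ { root → fromBody root (noBoundPrefix-[] λ b → m≢1+m+n x (BoundOcc-var b)) }
  ... | equal _ = substBoundVar x Ψ (subst (Pointwise _≈T_ _) ([∶]-self x τ) σs≈)
  ... | greater _ m =
    substituted ax ≈T-refl
      (λ y y<k → trans ([∶]-other τ (<⇒≢ (<-≤-trans y<k (m≤m+n k m))))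
                       (sym ([∶]-other τ (<⇒≢ (<-≤-trans y<k (m≤n⇒m≤1+n (m≤m+n k m)))))))
      (s≤s z≤n)
      λ { root → fromBody root (noBoundPrefix-[] λ b → m≢1+m+n k (sym (BoundOcc-var b))) }
  substDerivation k val Ψ σs≈ =
    substituted val ≈T-refl (λ _ _ → refl) (s≤s z≤n)
      λ { root → fromBody root (noBoundPrefix-[] λ ()) }
  substDerivation k (⇒i {Γ = Γ} Φ) Ψ σs≈ with substDerivation (suc k) Φ Ψ σs≈
  ... | substituted Φ′ τ′≈τ agree size-subst toc-subst =
    substituted (⇒i Φ′) (⇒≈ (subst (_≈M Γ 0) (sym (agree 0 (s≤s z≤n))) ≈M-refl) τ′≈τ)
      (λ y y<k → agree (suc y) (s≤s y<k)) (s≤s size-subst)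
      λ { root     → fromBody root (noBoundPrefix-[] λ ())
        ; (inλ w∈) → trace-lam inλ id (toc-subst w∈) }
  substDerivation k (⇒e {Γ = Γ} Φ Ψ₀ e) Ψ σs≈ =
    let sp = splitArgs (Γ k) Ψ σs≈
    in  substituted-⇒e sp (substDerivation k Φ (ArgsSplit.Ψ₁ sp) (ArgsSplit.σs₁≈M sp))
                          (substArgs k Ψ₀ (ArgsSplit.Ψ₂ sp) (ArgsSplit.σs₂≈N sp))

  substArgs : ∀ k {v Δ₀ u σs₀ Δ σs} (Ψ₀ : Args Δ₀ u σs₀) (Ψ : Args Δ v σs) →
              Pointwise _≈T_ σs (Δ₀ k) → SubstArgs k Ψ₀ Ψ (sub k v u)
  substArgs k [] Ψ σs≈ = substitutedArgs [] [] (λ _ _ → refl) z≤n λ ()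
  substArgs k (_∷_ {Δ = Δ₁} Φ Ψ₀) Ψ σs≈ =
    let sp = splitArgs (Δ₁ k) Ψ σs≈
    in  substituted-∷ sp (substDerivation k Φ (ArgsSplit.Ψ₁ sp) (ArgsSplit.σs₁≈M sp))
                         (substArgs k Ψ₀ (ArgsSplit.Ψ₂ sp) (ArgsSplit.σs₂≈N sp))

ReflectsResiduals : ∀ {Γ t τ Γ′ t′ τ′} → Γ ⊢ t ∶ τ → Pos → Γ′ ⊢ t′ ∶ τ′ → Set
ReflectsResiduals {t = t} {t′ = t′} Φ p Φ′ =
  ∀ {q q′} → q ∈oc t → Res t p q q′ → q′ ∈oc t′ × (q′ ∈toc Φ′ → q ∈toc Φ)

record HeadStep {Γ t τ} (Φ : Γ ⊢ t ∶ τ) : Set where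
  constructor headStep
  field
    {p}         : Pos
    {t′}        : Tm
    contraction : t ⟶[ p ] t′
    p-typed     : p ∈toc Φ
    {Γ′}        : Ctx
    {τ′}        : Ty
    Φ′          : Γ′ ⊢ t′ ∶ τ′
    τ′≈τ        : τ′ ≈T τ
    smaller     : size Φ′ < size Φ
    residuals   : ReflectsResiduals Φ p Φ′

β-reflects-residuals : ∀ {Γ s τ Δ v σs Δ′ σs′ Γ′ τ′} {Φ : Γ ⊢ s ∶ τ} {Ψ : Args Δ v σs}
                       {e : σs ≈M Γ 0} {Ψ′ : Args Δ′ v σs′} (Φ′ : Γ′ ⊢ s [ v ] ∶ τ′) →
                       (∀ {w} → w ∈tocArgs Ψ′ → w ∈tocArgs Ψ) →
                       (∀ {w} → w ∈toc Φ′ → SubstTrace (_∈toc Φ) (_∈tocArgs Ψ′) s 0 w) →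
                       ReflectsResiduals (⇒e (⇒i Φ) Ψ e) [] Φ′
β-reflects-residuals Φ′ toc-perm toc-subst {q} _ (out q⋡[]) = ⊥-elim (q⋡[] (q , refl))
β-reflects-residuals {s = s} {v = v} {Φ = Φ} {Ψ′ = Ψ′} Φ′ toc-perm toc-subst {d0 ∷ d0 ∷ w}
  (_ , w∈s) (body refl) =
  ∈oc-sub 0 v s {w} (_ , w∈s) , inFn ∘ inλ ∘ from-body ∘ toc-subst
  where
    from-body : SubstTrace (_∈toc Φ) (_∈tocArgs Ψ′) s 0 w → w ∈toc Φ
    from-body (fromBody w∈ _) = w∈
    from-body (fromArg refl b w₁∈ _) with BoundOcc-maximal _ b (_ , w∈s)
    ... | refl = subst (_∈toc Φ) (sym (++-identityʳ _)) w₁∈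
β-reflects-residuals {s = s} {v = v} {Φ = Φ} {Ψ′ = Ψ′} Φ′ toc-perm toc-subst {d1 ∷ w}
  (_ , w∈v) (arg {w' = w₁} refl b) with at-sub-BoundOcc v b
... | n , at-w₁ =
  (_ , trans (at-++ (s [ v ]) w₁ w at-w₁) (proj₂ (∈oc-shiftN n v {w} (_ , w∈v)))) ,
  inArg ∘ toc-perm ∘ from-arg ∘ toc-subst
  where
    from-arg : SubstTrace (_∈toc Φ) (_∈tocArgs Ψ′) s 0 (w₁ ++ w) → w ∈tocArgs Ψ′
    from-arg (fromBody _ nb)           = ⊥-elim (nb b (w , refl))
    from-arg (fromArg eq b′ _ w₂∈) with BoundOcc-++-cancel b b′ eq
    ... | refl = w₂∈

headStep-β : ∀ {Γ s M τ Δ v σs} (Φ : Γ ⊢ lam s ∶ (M ⇒ τ)) (Ψ : Args Δ v σs) (e : σs ≈M M) →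
             HeadStep (⇒e Φ Ψ e)
headStep-β (⇒i Φ) Ψ e with permuteArgs Ψ e
... | argsPermutation Ψ′ σs′≈ size-perm toc-perm with substDerivation 0 Φ Ψ′ σs′≈
...   | substituted Φ′ τ′≈τ _ size-subst toc-subst =
  headStep β root Φ′ τ′≈τ
    (s≤s (≤-trans (≤-trans size-subst (≤-reflexive (cong (size Φ +_) size-perm))) (n≤1+n _)))
    (β-reflects-residuals Φ′ toc-perm toc-subst)

headStep-appL : ∀ {Γ a M τ Δ b σs} {Φ : Γ ⊢ a ∶ (M ⇒ τ)} (Ψ : Args Δ b σs) (e : σs ≈M M) →
                HeadStep Φ → HeadStep (⇒e Φ Ψ e)
headStep-appL {Φ = Φ} Ψ e
  (headStep {p} contraction p-typed Φ′ (⇒≈ M′≈M τ′≈τ) smaller residuals) =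
  headStep (appL contraction) (inFn p-typed) (⇒e Φ′ Ψ (≈M-trans e (≈M-sym M′≈M))) τ′≈τ
    (s≤s (+-monoˡ-< (sizeArgs Ψ) smaller)) residuals′
  where
    residuals′ : ReflectsResiduals (⇒e Φ Ψ e) (d0 ∷ p) (⇒e Φ′ Ψ (≈M-trans e (≈M-sym M′≈M)))
    residuals′ {[]}     _  (out _) = (_ , refl) , λ _ → root
    residuals′ {d0 ∷ q} q∈ (out q⋡p) with residuals q∈ (out (q⋡p ∘ map₂ (cong (d0 ∷_))))
    ... | q′∈ , reflect = q′∈ , λ { (inFn w∈) → inFn (reflect w∈) }
    residuals′ {d1 ∷ q} q∈ (out _) = q∈ , λ { (inArg w∈) → inArg w∈ }
    residuals′ q∈ (body eq) with residuals q∈ (body eq)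
    ... | q′∈ , reflect = q′∈ , λ { (inFn w∈) → inFn (reflect w∈) }
    residuals′ q∈ (arg eq b) with residuals q∈ (arg eq b)
    ... | q′∈ , reflect = q′∈ , λ { (inFn w∈) → inFn (reflect w∈) }

whnfOrHeadStep : ∀ {Γ t τ} (Φ : Γ ⊢ t ∶ τ) → WHNF t ⊎ HeadStep Φ
whnfOrHeadStep ax     = inj₁ (neutral var)
whnfOrHeadStep val    = inj₁ lam
whnfOrHeadStep (⇒i Φ) = inj₁ lam
whnfOrHeadStep (⇒e Φ Ψ e) with whnfOrHeadStep Φ
... | inj₁ lam         = inj₂ (headStep-β Φ Ψ e)
... | inj₁ (neutral n) = inj₁ (neutral (app n))
... | inj₂ h           = inj₂ (headStep-appL Ψ e h)

record ReachesWHNF {Γ t τ} (Φ : Γ ⊢ t ∶ τ) : Set where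
  constructor reaches
  field
    {u}        : Tm
    ρ          : t ↠ u
    whnf       : WHNF u
    used-typed : ∀ {q} → q ∈oc t → Used ρ q → q ∈toc Φ

used-typed-step : ∀ {Γ t τ Γ′ t′ τ′ u p} {Φ : Γ ⊢ t ∶ τ} {Φ′ : Γ′ ⊢ t′ ∶ τ′}
                  (st : t ⟶[ p ] t′) (ρ : t′ ↠ u) → p ∈toc Φ → ReflectsResiduals Φ p Φ′ →
                  (∀ {q} → q ∈oc t′ → Used ρ q → q ∈toc Φ′) →
                  ∀ {q} → q ∈oc t → Used (step st ρ) q → q ∈toc Φ
used-typed-step st ρ p-typed residuals used-typed q∈ here = p-typed
used-typed-step st ρ p-typed residuals used-typed q∈ (there r used) =
  let q′∈ , reflect = residuals q∈ r in reflect (used-typed q′∈ used)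

reachWHNF : ∀ {Γ t τ} (Φ : Γ ⊢ t ∶ τ) → Acc _<_ (size Φ) → ReachesWHNF Φ
reachWHNF Φ (acc rs) with whnfOrHeadStep Φ
... | inj₁ whnf = reaches done whnf λ _ ()
... | inj₂ (headStep st p-typed Φ′ _ smaller residuals) with reachWHNF Φ′ (rs smaller)
...   | reaches ρ whnf used-typed =
  reaches (step st ρ) whnf (used-typed-step st ρ p-typed residuals used-typed)

mainTheorem3 : (t : Tm) (r : Pos) → WHNeeded t r →
               ∀ {Γ τ} (Φ : Γ ⊢ t ∶ τ) → r ∈toc Φ
mainTheorem3 t r ((_ , _ , r-redex) , needed) Φ with reachWHNF Φ (<-wellFounded (size Φ))
... | reaches ρ whnf used-typed = used-typed (_ , r-redex) (needed ρ whnf)
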